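{- For all integers $k,p>0$, the number $J_k(p)$ of words $v\in\{a,b\}^k$ with $h(v)=p$ equals \[J_k(p)=2^{p-1}\left(\binom{k-p+1}{p-1}+\binom{k-p}{p-1}\right),\] with the convention $\binom{n}{m}=0$ whenever $n<m$.
   Context: A word is constant if it is a power of one letter (including $\varepsilon$). For non-constant $u$, ${}_+u$ is the longest suffix of $u$ immediately preceded by the letter different from the first letter of $u$. Height: $v_{(1)}=v$, $v_{(n+1)}={}_+(v_{(n)})$ while $v_{(n)}$ is non-constant; $h(v)$ is the index $h$ such that $v_{(h)}$ is constant. -}

module Defs where

open import Data.Bool using (Bool; true; false; not; _∧_; if_then_else_)
open import Data.Bool.Properties using () renaming (_≟_ to _≟ᵇ_)
open import Data.Nat using (ℕ; zero; suc)
open import Data.List using (List; []; _∷_; length; filter)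
open import Relation.Nullary using (does)

-- Letters: a = false, b = true.  Words over {a,b} are lists of Bool.
Letter : Set
Letter = Bool

Word : Set
Word = List Letter

allEq : Letter → Word → Bool
allEq x [] = true
allEq x (y ∷ ys) = does (x ≟ᵇ y) ∧ allEq x ys

isConstant : Word → Bool
isConstant [] = true
isConstant (x ∷ xs) = allEq x xs

-- For u = x ∷ w: the longest suffix of u immediately preceded by a letter
-- ≠ x is the suffix following the leftmost occurrence in w of a letter ≠ x.
suffixAfterFirst≠ : Letter → Word → Word
suffixAfterFirst≠ x [] = []
suffixAfterFirst≠ x (y ∷ ys) = if does (x ≟ᵇ y) then suffixAfterFirst≠ x ys else ys

-- ₊u  (meaningful for non-constant u)
plus : Word → Word
plus [] = []
plus (x ∷ w) = suffixAfterFirst≠ x w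

-- Height: v₍₁₎ = v, v₍ₙ₊₁₎ = ₊(v₍ₙ₎) while v₍ₙ₎ is non-constant;
-- h(v) is the index h with v₍ₕ₎ constant.  Since |₊u| < |u|, fuel |v|+1
-- suffices.
heightFuel : ℕ → Word → ℕ
heightFuel zero v = 1
heightFuel (suc n) v = if isConstant v then 1 else suc (heightFuel n (plus v))

height : Word → ℕ
height v = heightFuel (length v) v

words : ℕ → List Word
words zero = [] ∷ []
words (suc k) = Data.List.concatMap (λ w → (false ∷ w) ∷ (true ∷ w) ∷ []) (words k)
  where import Data.List

J : ℕ → ℕ → ℕ
J k p = length (filter (λ v → Data.Nat._≟_ (height v) p) (words k))
  where import Data.Nat

-- Write g_k(p) for the number of words w of length k with h(xw) = p.  Since
-- h(xxw) = h(xw) and h(xyw) = 1 + h(w) for y ≠ x, we get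
-- g_{k+1}(p+1) = g_k(p+1) + J_k(p); this recurrence does not involve x, so g_k is
-- independent of x and J_{k+1}(p) = 2 g_k(p).  Hence
-- J_{k+2}(p+1) = J_{k+1}(p+1) + 2 J_k(p), and Pascal's rule shows that the closed
-- form obeys the same recurrence; it agrees with J for p = 1 and for k ≤ 2.
module Submission where

open import Defs
open import Data.Nat using (ℕ; suc; _+_; _*_; _∸_; _^_; _>_)
open import Data.Nat.Combinatorics using (_C_)
open import Relation.Binary.PropositionalEquality using (_≡_)

open import Data.Bool using (Bool; true; false; if_then_else_)
open import Data.Bool.Properties using () renaming (_≟_ to _≟ᵇ_)
open import Data.List using (List; []; _∷_; length; filter; concatMap)
open import Data.Nat using (zero; _≤_; _<_; z≤n; s≤s; _≟_; _≤?_)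
open import Data.Nat.Properties
  using (+-comm; ≤-refl; ≤-trans; ≤-<-trans; n≤1+n; m∸n≤m; ∸-monoʳ-≤; +-∸-assoc;
         ≰⇒>; m<n+o⇒m∸n<o; +-mono-≤; *-zeroʳ)
open import Data.Nat.Combinatorics using (nCk+nC[k+1]≡[n+1]C[k+1]; k>n⇒nCk≡0)
open import Data.Nat.Tactic.RingSolver using (solve-∀)
open import Function using (_∘_)
open import Relation.Nullary using (does; yes; no)
open import Relation.Unary using (Pred; Decidable)
open import Relation.Binary.PropositionalEquality using (refl; sym; trans; cong; cong₂; module ≡-Reasoning)

-- height∷ x w is the height of x ∷ w: ₊(x ∷ x ∷ w) = ₊(x ∷ w) and ₊(x ∷ y ∷ w) = w for y ≠ x.
height′ : Word → ℕ
height∷ : Letter → Word → ℕ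

height′ [] = 1
height′ (x ∷ w) = height∷ x w

height∷ x [] = 1
height∷ x (y ∷ w) = if does (x ≟ᵇ y) then height∷ x w else suc (height′ w)

height∷-unfold : ∀ x w →
  height∷ x w ≡ (if allEq x w then 1 else suc (height′ (suffixAfterFirst≠ x w)))
height∷-unfold x [] = refl
height∷-unfold x (y ∷ w) with does (x ≟ᵇ y)
... | true = height∷-unfold x w
... | false = refl

length-suffixAfterFirst≠ : ∀ x w → length (suffixAfterFirst≠ x w) ≤ length w
length-suffixAfterFirst≠ x [] = z≤n
length-suffixAfterFirst≠ x (y ∷ w) with does (x ≟ᵇ y)
... | true = ≤-trans (length-suffixAfterFirst≠ x w) (n≤1+n _)
... | false = n≤1+n _

heightFuel≡height′ : ∀ n v → length v ≤ n → heightFuel n v ≡ height′ v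
heightFuel≡height′ zero [] _ = refl
heightFuel≡height′ (suc n) [] _ = refl
heightFuel≡height′ (suc n) (x ∷ w) (s≤s |w|≤n) rewrite height∷-unfold x w with allEq x w
... | true = refl
... | false = cong suc (heightFuel≡height′ n (suffixAfterFirst≠ x w)
                         (≤-trans (length-suffixAfterFirst≠ x w) |w|≤n))

height≡height′ : ∀ v → height v ≡ height′ v
height≡height′ v = heightFuel≡height′ (length v) v ≤-refl

indicator : Bool → ℕ
indicator b = if b then 1 else 0

count : (Word → Bool) → List Word → ℕ
count P [] = 0
count P (w ∷ ws) = indicator (P w) + count P ws

length-filter≡count : ∀ {ℓ} {P : Pred Word ℓ} (P? : Decidable P) ws →
  length (filter P? ws) ≡ count (does ∘ P?) ws
length-filter≡count P? [] = refl
length-filter≡count P? (w ∷ ws) with does (P? w)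
... | true = cong suc (length-filter≡count P? ws)
... | false = length-filter≡count P? ws

count-cong : ∀ {P Q} → (∀ w → P w ≡ Q w) → ∀ ws → count P ws ≡ count Q ws
count-cong P≡Q [] = refl
count-cong P≡Q (w ∷ ws) = cong₂ _+_ (cong indicator (P≡Q w)) (count-cong P≡Q ws)

count-false : ∀ ws → count (λ _ → false) ws ≡ 0
count-false [] = refl
count-false (w ∷ ws) = count-false ws

count-words-suc : ∀ P k →
  count P (words (suc k)) ≡ count (P ∘ (false ∷_)) (words k) + count (P ∘ (true ∷_)) (words k)
count-words-suc P k = go (words k)
  where
  interchange : ∀ a b c d → a + (b + (c + d)) ≡ (a + c) + (b + d)
  interchange = solve-∀

  go : ∀ ws → count P (concatMap (λ w → (false ∷ w) ∷ (true ∷ w) ∷ []) ws)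
            ≡ count (P ∘ (false ∷_)) ws + count (P ∘ (true ∷_)) ws
  go [] = refl
  go (w ∷ ws) = trans (cong (λ n → indicator (P (false ∷ w)) + (indicator (P (true ∷ w)) + n)) (go ws))
                      (interchange (indicator (P (false ∷ w))) (indicator (P (true ∷ w)))
                                   (count (P ∘ (false ∷_)) ws) (count (P ∘ (true ∷_)) ws))

#height : ℕ → ℕ → ℕ
#height k p = count (λ v → does (height′ v ≟ p)) (words k)

#height∷ : Letter → ℕ → ℕ → ℕ
#height∷ x k p = count (λ w → does (height∷ x w ≟ p)) (words k)

#suc∘height : ℕ → ℕ → ℕ
#suc∘height k p = count (λ w → does (suc (height′ w) ≟ p)) (words k)

J≡#height : ∀ k p → J k p ≡ #height k p
J≡#height k p = trans (length-filter≡count (λ v → height v ≟ p) (words k))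
  (count-cong (λ v → cong (λ h → does (h ≟ p)) (height≡height′ v)) (words k))

#height∷-suc : ∀ x k p → #height∷ x (suc k) p ≡ #height∷ x k p + #suc∘height k p
#height∷-suc false k p = count-words-suc (λ w → does (height∷ false w ≟ p)) k
#height∷-suc true k p = trans (count-words-suc (λ w → does (height∷ true w ≟ p)) k)
                              (+-comm (#suc∘height k p) (#height∷ true k p))

#height∷-letter-independent : ∀ k p → #height∷ false k p ≡ #height∷ true k p
#height∷-letter-independent zero p = refl
#height∷-letter-independent (suc k) p = begin
  #height∷ false (suc k) p                  ≡⟨ #height∷-suc false k p ⟩
  #height∷ false k p + #suc∘height k p      ≡⟨ cong (_+ #suc∘height k p) (#height∷-letter-independent k p) ⟩
  #height∷ true k p + #suc∘height k p       ≡⟨ #height∷-suc true k p ⟨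
  #height∷ true (suc k) p                   ∎
  where open ≡-Reasoning

#height-suc : ∀ k p → #height (suc k) p ≡ #height∷ false k p + #height∷ false k p
#height-suc k p = trans (count-words-suc (λ v → does (height′ v ≟ p)) k)
  (cong (#height∷ false k p +_) (sym (#height∷-letter-independent k p)))

#height∷-zero : ∀ k → #height∷ false k 0 ≡ 0
#height∷-zero zero = refl
#height∷-zero (suc k) = trans (#height∷-suc false k 0) (cong₂ _+_ (#height∷-zero k) (count-false (words k)))

#height-zero : ∀ k → #height k 0 ≡ 0
#height-zero zero = refl
#height-zero (suc k) = trans (#height-suc k 0) (cong₂ _+_ (#height∷-zero k) (#height∷-zero k))

#height∷-one : ∀ k → #height∷ false k 1 ≡ 1
#height∷-one zero = refl
#height∷-one (suc k) = trans (#height∷-suc false k 1) (cong₂ _+_ (#height∷-one k) (#height-zero k))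

#height-one : ∀ k → #height (suc k) 1 ≡ 2
#height-one k = trans (#height-suc k 1) (cong₂ _+_ (#height∷-one k) (#height∷-one k))

#height-recurrence : ∀ k p → #height (2 + k) (1 + p) ≡ #height (1 + k) (1 + p) + 2 * #height k p
#height-recurrence k p = begin
  #height (2 + k) (1 + p)                 ≡⟨ #height-suc (suc k) (suc p) ⟩
  G (1 + k) + G (1 + k)                   ≡⟨ cong₂ _+_ (#height∷-suc false k (suc p)) (#height∷-suc false k (suc p)) ⟩
  (G k + #height k p) + (G k + #height k p) ≡⟨ regroup (G k) (#height k p) ⟩
  (G k + G k) + 2 * #height k p           ≡⟨ cong (_+ 2 * #height k p) (#height-suc k (suc p)) ⟨
  #height (1 + k) (1 + p) + 2 * #height k p ∎
  where
  open ≡-Reasoning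
  G : ℕ → ℕ
  G n = #height∷ false n (suc p)
  regroup : ∀ a b → (a + b) + (a + b) ≡ (a + a) + 2 * b
  regroup = solve-∀

pascal-∸ : ∀ m n → (suc m ∸ n) C suc n ≡ (m ∸ n) C n + (m ∸ n) C suc n
pascal-∸ m n with n ≤? m
... | yes n≤m = trans (cong (_C suc n) (+-∸-assoc 1 n≤m)) (sym (nCk+nC[k+1]≡[n+1]C[k+1] (m ∸ n) n))
... | no n≰m = trans (k>n⇒nCk≡0 (s≤s (≤-trans (m∸n≤m (suc m) n) m<n)))
                     (sym (cong₂ _+_ (k>n⇒nCk≡0 m∸n<n) (k>n⇒nCk≡0 (≤-trans m∸n<n (n≤1+n n)))))
  where
  m<n : m < n
  m<n = ≰⇒> n≰m
  m∸n<n : m ∸ n < n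
  m∸n<n = ≤-<-trans (m∸n≤m m n) m<n

closedForm : ℕ → ℕ → ℕ
closedForm k p = 2 ^ (p ∸ 1) * ((suc k ∸ p) C (p ∸ 1) + (k ∸ p) C (p ∸ 1))

closedForm-recurrence : ∀ k p →
  closedForm (3 + k) (2 + p) ≡ closedForm (2 + k) (2 + p) + 2 * closedForm (1 + k) (1 + p)
closedForm-recurrence k p = begin
  closedForm (3 + k) (2 + p)
    ≡⟨⟩
  2 * x * ((2 + k ∸ p) C (1 + p) + (1 + k ∸ p) C (1 + p))
    ≡⟨ cong₂ (λ c d → 2 * x * (c + d)) (pascal-∸ (suc k) p) (pascal-∸ k p) ⟩
  2 * x * ((A + B) + (E + D))
    ≡⟨ distribute x A B E D ⟩
  2 * x * (B + D) + 2 * (x * (A + E))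
    ≡⟨⟩
  closedForm (2 + k) (2 + p) + 2 * closedForm (1 + k) (1 + p)
    ∎
  where
  open ≡-Reasoning
  x A B E D : ℕ
  x = 2 ^ p
  A = (1 + k ∸ p) C p
  B = (1 + k ∸ p) C (1 + p)
  E = (k ∸ p) C p
  D = (k ∸ p) C (1 + p)
  distribute : ∀ x A B E D → 2 * x * ((A + B) + (E + D)) ≡ 2 * x * (B + D) + 2 * (x * (A + E))
  distribute = solve-∀

closedForm-vanishes : ∀ k p → k < p + p → closedForm k (suc p) ≡ 0
closedForm-vanishes k zero ()
closedForm-vanishes k p@(suc _) k<2p = trans
  (cong (2 ^ p *_) (cong₂ _+_ (k>n⇒nCk≡0 k∸p<p) (k>n⇒nCk≡0 (≤-<-trans (∸-monoʳ-≤ k (n≤1+n p)) k∸p<p))))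
  (*-zeroʳ (2 ^ p))
  where
  k∸p<p : k ∸ p < p
  k∸p<p = m<n+o⇒m∸n<o k p k<2p

#height≡closedForm : ∀ k p → #height (suc k) (suc p) ≡ closedForm (suc k) (suc p)
#height≡closedForm k zero = #height-one k
-- #height 1 (2 + p) and #height 2 (3 + p) evaluate to 0 outright.
#height≡closedForm zero p@(suc _) = sym (closedForm-vanishes 1 p (+-mono-≤ (s≤s z≤n) (s≤s z≤n)))
#height≡closedForm (suc zero) (suc zero) = refl
#height≡closedForm (suc zero) p@(suc (suc _)) =
  sym (closedForm-vanishes 2 p (≤-trans (n≤1+n 3) (+-mono-≤ (s≤s (s≤s z≤n)) (s≤s (s≤s z≤n)))))
#height≡closedForm (suc (suc k)) (suc p) = begin
  #height (3 + k) (2 + p)                                  ≡⟨ #height-recurrence (suc k) (suc p) ⟩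
  #height (2 + k) (2 + p) + 2 * #height (1 + k) (1 + p)    ≡⟨ cong₂ (λ a b → a + 2 * b) (#height≡closedForm (suc k) (suc p)) (#height≡closedForm k p) ⟩
  closedForm (2 + k) (2 + p) + 2 * closedForm (1 + k) (1 + p) ≡⟨ closedForm-recurrence k p ⟨
  closedForm (3 + k) (2 + p)                               ∎
  where open ≡-Reasoning

mainTheorem16 : ∀ (k p : ℕ) → k > 0 → p > 0 →
    J k p ≡ 2 ^ (p ∸ 1) * (((k + 1) ∸ p) C (p ∸ 1) + (k ∸ p) C (p ∸ 1))
mainTheorem16 k@(suc k′) p@(suc p′) _ _ = begin
  J k p              ≡⟨ J≡#height k p ⟩
  #height k p        ≡⟨ #height≡closedForm k′ p′ ⟩
  closedForm k p     ≡⟨ cong (λ n → 2 ^ p′ * ((n ∸ p) C p′ + (k ∸ p) C p′)) (+-comm 1 k) ⟩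
  2 ^ p′ * (((k + 1) ∸ p) C p′ + (k ∸ p) C p′) ∎
  where open ≡-Reasoning
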